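{- Let $\mathcal{L}$ be a Cameron-Liebler $k$-set in $\mathrm{AG}(n,q)$. Suppose now that $\pi$ is an $i$-dimensional subspace in $\mathrm{AG}(n,q)$, with $i\geq k+1$, then $\mathcal{L}\cap [\pi]_k$ is a Cameron-Liebler $k$-set in $\pi$.
   Context: A Cameron-Liebler $k$-set in $\mathrm{AG}(n,q)$ ($n\geq 2k+1$) is a set $\mathcal{L}$ of $k$-spaces whose characteristic vector lies in the row space of the point-($k$-space) incidence matrix of $\mathrm{AG}(n,q)$, equivalently a set of $k$-spaces meeting every $k$-spread (partition of the point set into $k$-spaces) in a constant number $x$ of elements; its parameter $x$ satisfies $|\mathcal{L}|=x\begin{bmatrix} n \\ k\end{bmatrix}_q$, with $\begin{bmatrix} b \\ a\end{bmatrix}_q=\frac{(q^b-1)\cdots(q^{b-a+1}-1)}{(q^a-1)\cdots(q-1)}$. $[\pi]_k$ denotes the set of $k$-spaces contained in $\pi$. -}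

module Defs where

open import Level using (0ℓ)
open import Data.Bool using (Bool; true; false; _∧_; _∨_; not; if_then_else_)
open import Data.Nat as ℕ using (ℕ)
open import Data.Product using (Σ; ∃; _×_; _,_)
open import Data.List as List using (List; []; _∷_; length; filter; concatMap; map; foldr)
open import Data.List.Membership.Propositional using (_∈_)
open import Data.List.Relation.Unary.Unique.Propositional using (Unique)
open import Data.Vec as Vec using (Vec; []; _∷_; zipWith; replicate)
open import Data.Rational as ℚ using (ℚ; 0ℚ; 1ℚ)
open import Relation.Binary.PropositionalEquality using (_≡_)
open import Relation.Binary.Definitions using (DecidableEquality)
open import Relation.Nullary using (¬_)
open import Algebra.Structures using (IsCommutativeRing)
open import Function.Bundles using (_⇔_)

record FiniteField : Set₁ where
  field
    Carrier : Set
    _+_ _*_ : Carrier → Carrier → Carrier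
    -_ : Carrier → Carrier
    0# 1# : Carrier
    isCommutativeRing : IsCommutativeRing _≡_ _+_ _*_ -_ 0# 1#
    0≢1 : ¬ (0# ≡ 1#)
    inverse : ∀ x → ¬ (x ≡ 0#) → ∃ λ y → x * y ≡ 1#
    _≟_ : DecidableEquality Carrier
    elems : List Carrier
    complete : ∀ x → x ∈ elems
    unique : Unique elems

module AG (F : FiniteField) (n : ℕ) where
  open FiniteField F

  Point : Set
  Point = Vec Carrier n

  _⊕_ : Point → Point → Point
  _⊕_ = zipWith _+_

  _·_ : Carrier → Point → Point
  a · v = Vec.map (a *_) v

  𝟎 : Point
  𝟎 = replicate n 0#

  comb : ∀ {k} → Vec Carrier k → Vec Point k → Point
  comb [] [] = 𝟎
  comb (a ∷ as) (v ∷ vs) = (a · v) ⊕ comb as vs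

  LinIndep : ∀ {k} → Vec Point k → Set
  LinIndep {k} vs = ∀ (as : Vec Carrier k) → comb as vs ≡ 𝟎 → as ≡ replicate k 0#

  allVecs : (m : ℕ) → List (Vec Carrier m)
  allVecs ℕ.zero = [] ∷ []
  allVecs (ℕ.suc m) = concatMap (λ a → map (a ∷_) (allVecs m)) elems

  allPoints : List Point
  allPoints = allVecs n

  PointSet : Set
  PointSet = Point → Bool

  IsSubspace : ℕ → PointSet → Set
  IsSubspace k S = Σ Point λ b → Σ (Vec Point k) λ vs → LinIndep vs ×
    (∀ P → (S P ≡ true) ⇔ (∃ λ (as : Vec Carrier k) → P ≡ b ⊕ comb as vs))

  _⊆_ : PointSet → PointSet → Set
  S ⊆ T = ∀ P → S P ≡ true → T P ≡ true

  _⊆ᵇ_ : PointSet → PointSet → Bool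
  S ⊆ᵇ T = foldr (λ P r → (not (S P) ∨ T P) ∧ r) true allPoints

  wholeSpace : PointSet
  wholeSpace _ = true

  χ : Bool → ℚ
  χ true = 1ℚ
  χ false = 0ℚ

  sumOver : PointSet → (Point → ℚ) → ℚ
  sumOver S c = foldr (λ P r → (if S P then c P else 0ℚ) ℚ.+ r) 0ℚ allPoints

  -- Cameron-Liebler k-set in the subspace π: L consists of k-spaces contained
  -- in π, and its characteristic vector (indexed by the k-spaces of π) lies in
  -- the row space of the point-(k-space) incidence matrix of π, i.e.
  -- χ_L(K) = Σ_{P ∈ K} c(P) for some weights c on points, for all k-spaces K ⊆ π.
  IsCameronLieblerIn : (k : ℕ) → PointSet → (PointSet → Bool) → Set
  IsCameronLieblerIn k π L =
    (∀ K → L K ≡ true → IsSubspace k K × K ⊆ π) ×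
    (Σ (Point → ℚ) λ c → ∀ K → IsSubspace k K → K ⊆ π → χ (L K) ≡ sumOver K c)

  IsCameronLiebler : (k : ℕ) → (PointSet → Bool) → Set
  IsCameronLiebler k L = IsCameronLieblerIn k wholeSpace L

  restrict : (PointSet → Bool) → PointSet → (PointSet → Bool)
  restrict L π K = L K ∧ (K ⊆ᵇ π)

{-# OPTIONS --safe #-}
module Submission where

-- Restricting to π keeps the same point weights c: for a k-space K ⊆ π, K lies in
-- L ∩ [π]_k exactly when it lies in L, and χ_L(K) = Σ_{P ∈ K} c(P) already holds.

open import Defs
open import Data.Bool using (Bool; true; false; _∧_; _∨_; not)
open import Data.Bool.Properties using (∧-identityʳ)
open import Data.Nat using (ℕ; zero; suc; _≤_; _+_; _*_)
open import Data.List using (List; []; _∷_; foldr; map)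
open import Data.List.Relation.Unary.Any using (here; there)
open import Data.List.Membership.Propositional using (_∈_; lose)
open import Data.List.Membership.Propositional.Properties using (∈-concatMap⁺; ∈-map⁺)
open import Data.Vec using (Vec; []; _∷_)
open import Data.Product using (_×_; _,_; proj₁)
open import Relation.Binary.PropositionalEquality using (_≡_; refl; cong; cong₂; module ≡-Reasoning)

∧-true₁ : ∀ {a b} → a ∧ b ≡ true → a ≡ true
∧-true₁ {true} _ = refl

∧-true₂ : ∀ {a b} → a ∧ b ≡ true → b ≡ true
∧-true₂ {true} b≡true = b≡true

implies-true : ∀ {a b} → not a ∨ b ≡ true → a ≡ true → b ≡ true
implies-true {true} b≡true _ = b≡true

module _ (F : FiniteField) (n : ℕ) where
  open FiniteField F
  open AG F n

  ∈-allVecs : ∀ m (v : Vec Carrier m) → v ∈ allVecs m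
  ∈-allVecs zero [] = here refl
  ∈-allVecs (suc m) (a ∷ v) =
    ∈-concatMap⁺ (λ b → map (b ∷_) (allVecs m)) (lose (complete a) (∈-map⁺ (a ∷_) (∈-allVecs m v)))

  ⊆-trans : ∀ {R S T} → R ⊆ S → S ⊆ T → R ⊆ T
  ⊆-trans R⊆S S⊆T P P∈R = S⊆T P (R⊆S P P∈R)

  allImply : PointSet → PointSet → List Point → Bool
  allImply S T = foldr (λ P r → (not (S P) ∨ T P) ∧ r) true

  allImply-sound : ∀ S T xs → allImply S T xs ≡ true →
                   ∀ {P} → P ∈ xs → S P ≡ true → T P ≡ true
  allImply-sound S T (x ∷ xs) h (here refl) = implies-true (∧-true₁ h)
  allImply-sound S T (x ∷ xs) h (there P∈xs) = allImply-sound S T xs (∧-true₂ h) P∈xs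

  ⊆⇒implies-true : ∀ {S T} → S ⊆ T → ∀ P → not (S P) ∨ T P ≡ true
  ⊆⇒implies-true {S} S⊆T P with S P in P∈S
  ... | false = refl
  ... | true = S⊆T P P∈S

  allImply-complete : ∀ {S T} → S ⊆ T → ∀ xs → allImply S T xs ≡ true
  allImply-complete S⊆T [] = refl
  allImply-complete S⊆T (x ∷ xs) =
    cong₂ _∧_ (⊆⇒implies-true S⊆T x) (allImply-complete S⊆T xs)

  ⊆ᵇ⇒⊆ : ∀ {S T} → S ⊆ᵇ T ≡ true → S ⊆ T
  ⊆ᵇ⇒⊆ {S} {T} h P = allImply-sound S T allPoints h (∈-allVecs n P)

  ⊆⇒⊆ᵇ : ∀ {S T} → S ⊆ T → S ⊆ᵇ T ≡ true
  ⊆⇒⊆ᵇ S⊆T = allImply-complete S⊆T allPoints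

  restrict-isCameronLieblerIn : ∀ {k σ π L} → π ⊆ σ →
    IsCameronLieblerIn k σ L → IsCameronLieblerIn k π (restrict L π)
  restrict-isCameronLieblerIn {k} {σ} {π} {L} π⊆σ (L⊆[σ]ₖ , c , χL≡Σc) = L∩[π]ₖ⊆[π]ₖ , c , χL∩[π]ₖ≡Σc
    where
    open ≡-Reasoning

    L∩[π]ₖ⊆[π]ₖ : ∀ K → restrict L π K ≡ true → IsSubspace k K × K ⊆ π
    L∩[π]ₖ⊆[π]ₖ K K∈L∩[π]ₖ = proj₁ (L⊆[σ]ₖ K (∧-true₁ K∈L∩[π]ₖ)) , ⊆ᵇ⇒⊆ (∧-true₂ K∈L∩[π]ₖ)

    χL∩[π]ₖ≡Σc : ∀ K → IsSubspace k K → K ⊆ π → χ (restrict L π K) ≡ sumOver K c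
    χL∩[π]ₖ≡Σc K K-subspace K⊆π = begin
      χ (L K ∧ (K ⊆ᵇ π)) ≡⟨ cong (λ b → χ (L K ∧ b)) (⊆⇒⊆ᵇ K⊆π) ⟩
      χ (L K ∧ true)     ≡⟨ cong χ (∧-identityʳ (L K)) ⟩
      χ (L K)            ≡⟨ χL≡Σc K K-subspace (⊆-trans K⊆π π⊆σ) ⟩
      sumOver K c        ∎

theorem3p6 : (F : FiniteField) (n k : ℕ) → 2 * k + 1 ≤ n →
    (L : AG.PointSet F n → Bool) → AG.IsCameronLiebler F n k L →
    (i : ℕ) (π : AG.PointSet F n) → AG.IsSubspace F n i π → k + 1 ≤ i →
    AG.IsCameronLieblerIn F n k π (AG.restrict F n L π)
theorem3p6 F n k _ L L-cameronLiebler i π _ _ =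
  restrict-isCameronLieblerIn F n (λ _ _ → refl) L-cameronLiebler
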